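{- Let $0\le j\le k\le n$ and suppose that $a,b$ are disjoint subsets of $\dot V$ with $|a|=k-j$ and $|b|=j$. Then $\sigma_k([a,b])=(k-2j)[a,b]$.
   Context: Let $\mathbb F$ be a field. Let $V=\{\alpha_1,\bar\alpha_1,\dots,\alpha_n,\bar\alpha_n\}$ be a set of $2n$ distinct elements, with $\bar{\bar\alpha}_i=\alpha_i$. For $0\le k\le n$, $L^n_k$ is the set of $k$-element subsets $x\subseteq V$ with $|x\cap\{\alpha_i,\bar\alpha_i\}|\le1$ for all $i$, and $M^n_k$ is the $\mathbb F$-vector space with basis $L^n_k$. Elements are written as polynomials in the vertices: a product of distinct vertices forming such a set denotes that set, extended bilinearly. $\sigma_k:M^n_k\to M^n_k$ is the linear map with $\sigma_k(x)=\sum_{\gamma\in x}(x\setminus\{\gamma\})\cup\{\bar\gamma\}$ for $x\in L^n_k$. Let $\dot V=\{\alpha_1,\dots,\alpha_n\}$; for disjoint $a,b\subseteq\dot V$, $[a,b]=\prod_{\alpha\in a}(\alpha+\bar\alpha)\prod_{\beta\in b}(\beta-\bar\beta)\in M^n_{|a|+|b|}$, with $[\emptyset,\emptyset]=\emptyset$. -}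

module Defs where

open import Level using (Level; suc; _⊔_)
open import Data.Nat as ℕ using (ℕ; zero; _≟_)
import Data.Nat
import Data.Vec
open import Data.Fin using (Fin)
open import Data.Fin.Subset using (Subset; Side; _∈_; inside; outside)
open import Data.Vec using (Vec; []; _∷_; _[_]≔_; lookup; allFin)
open import Data.List as List using (List; []; _∷_; concatMap; map; foldr)
open import Data.Bool using (Bool; true; false)
open import Data.Product using (Σ; _,_; _×_)
open import Relation.Nullary using (¬_; Dec; yes; no)
open import Relation.Binary.PropositionalEquality using (_≡_; refl)
open import Algebra.Bundles using (CommutativeRing)

record Field (c ℓ : Level) : Set (suc (c ⊔ ℓ)) where
  field
    commutativeRing : CommutativeRing c ℓ
  open CommutativeRing commutativeRing public
  field
    0≉1     : ¬ (0# ≈ 1#)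
    inverse : ∀ x → ¬ (x ≈ 0#) → Σ Carrier (λ y → (x * y) ≈ 1#)

-- For each index i : Fin n the pair {α_i, ᾱ_i}.
-- A set x ∈ L^n_k (at most one vertex of each pair) is encoded as a
-- vector x : Vec Slot n where x[i] = none (neither α_i nor ᾱ_i in x),
-- pos (α_i ∈ x) or neg (ᾱ_i ∈ x).

data Slot : Set where
  none pos neg : Slot

_≟S_ : (s t : Slot) → Dec (s ≡ t)
none ≟S none = yes refl
none ≟S pos  = no λ ()
none ≟S neg  = no λ ()
pos  ≟S none = no λ ()
pos  ≟S pos  = yes refl
pos  ≟S neg  = no λ ()
neg  ≟S none = no λ ()
neg  ≟S pos  = no λ ()
neg  ≟S neg  = yes refl

_≟V_ : ∀ {n} (x y : Vec Slot n) → Dec (x ≡ y)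
[] ≟V [] = yes refl
(s ∷ x) ≟V (t ∷ y) with s ≟S t | x ≟V y
... | yes refl | yes refl = yes refl
... | no ¬p    | _        = no λ { refl → ¬p refl }
... | yes _    | no ¬q    = no λ { refl → ¬q refl }

size : ∀ {n} → Vec Slot n → ℕ
size []         = 0
size (none ∷ x) = size x
size (pos  ∷ x) = ℕ.suc (size x)
size (neg  ∷ x) = ℕ.suc (size x)

L : ℕ → ℕ → Set
L n k = Σ (Vec Slot n) (λ x → size x ≡ k)

allSlotVecs : (n : ℕ) → List (Vec Slot n)
allSlotVecs zero        = [] ∷ []
allSlotVecs (ℕ.suc n) =
  concatMap (λ x → (none ∷ x) ∷ (pos ∷ x) ∷ (neg ∷ x) ∷ []) (allSlotVecs n)

bar : Slot → Slot
bar none = none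
bar pos  = neg
bar neg  = pos

flipAt : ∀ {n} → Fin n → Vec Slot n → Vec Slot n
flipAt i x = x [ i ]≔ bar (lookup x i)

module Over {c ℓ : Level} (F : Field c ℓ) where
  open Field F

  -- M^n_k : F-vector space with basis L^n_k, as coefficient functions
  M : ℕ → ℕ → Set c
  M n k = L n k → Carrier

  _≈M_ : ∀ {n k} → M n k → M n k → Set ℓ
  f ≈M g = ∀ x → f x ≈ g x

  _·_ : ∀ {n k} → Carrier → M n k → M n k
  (t · f) x = t * f x

  sumF : List Carrier → Carrier
  sumF = foldr _+_ 0#

  prodF : List Carrier → Carrier
  prodF = foldr _*_ 1#

  δ : ∀ {n} → Vec Slot n → Vec Slot n → Carrier
  δ x y with x ≟V y
  ... | yes _ = 1#
  ... | no  _ = 0#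

  -- coefficient of the basis element y in σ_k(x), for x ∈ L^n_k:
  -- σ_k(x) = Σ_{γ ∈ x} (x ∖ {γ}) ∪ {γ̄}; the vertices γ ∈ x are the
  -- positions i with x[i] ≠ none.
  σ-basis : ∀ {n} → Vec Slot n → Vec Slot n → Carrier
  σ-basis {n} x y = sumF (List.map term (Data.Vec.toList (allFin n)))
    where
    term : Fin n → Carrier
    term i with lookup x i
    ... | none = 0#
    ... | pos  = δ (flipAt i x) y
    ... | neg  = δ (flipAt i x) y

  σ : ∀ {n} (k : ℕ) → M n k → M n k
  σ {n} k f (y , _) = sumF (List.map term (allSlotVecs n))
    where
    term : Vec Slot n → Carrier
    term x with size x ≟ k
    ... | yes p = f (x , p) * σ-basis x y
    ... | no  _ = 0#

  -- [a,b] = ∏_{α∈a}(α+ᾱ) ∏_{β∈b}(β-β̄), expanded: the coefficient of a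
  -- basis set x is the product over i of the factor contributed at i.
  -- (a and b are assumed disjoint where this is used.)
  factor : Side → Side → Slot → Carrier
  factor inside  _       none = 0#
  factor inside  _       pos  = 1#
  factor inside  _       neg  = 1#
  factor outside inside  none = 0#
  factor outside inside  pos  = 1#
  factor outside inside  neg  = - 1#
  factor outside outside none = 1#
  factor outside outside pos  = 0#
  factor outside outside neg  = 0#

  bracket : ∀ {n k} → Subset n → Subset n → M n k
  bracket {n} a b (x , _) =
    prodF (List.map (λ i → factor (lookup a i) (lookup b i) (lookup x i))
                    (Data.Vec.toList (allFin n)))

  natF : ℕ → Carrier
  natF zero      = 0#
  natF (ℕ.suc m) = 1# + natF m

-- [a,b] is a tensor product over the pairs {αᵢ, ᾱᵢ} of the one-pair vectors α + ᾱ (i ∈ a),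
-- β - β̄ (i ∈ b) and ∅ (otherwise).  Extended to all sizes at once, σ acts on tensor products as
-- a derivation, σ(φ ⊗ h) = σ₁φ ⊗ h + φ ⊗ σh, where σ₁ swaps α and ᾱ and kills ∅.  The three
-- one-pair vectors are eigenvectors of σ₁ with eigenvalues 1, -1 and 0, so [a,b] is an
-- eigenvector of σ with eigenvalue |a| - |b| = (k - j) - j.
module Submission where

open import Defs
open import Data.Nat as ℕ using (ℕ; _≤_; _∸_)
open import Data.Fin.Subset using (Subset; _∈_; ∣_∣)
open import Data.Product using (_×_)
open import Relation.Nullary using (¬_)
open import Relation.Binary.PropositionalEquality using (_≡_)

open import Data.Empty using (⊥-elim)
open import Data.Fin using (Fin; zero; suc)
open import Data.Fin.Subset using (Side; inside; outside)
open import Data.List as List using (List; []; _∷_)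
open import Data.Product using (Σ; _,_; proj₁)
open import Data.Vec as Vec using (Vec; []; _∷_; lookup; allFin; toList; here; there)
open import Function using (id; _∘_)
open import Relation.Nullary using (Dec; yes; no)
import Algebra.Properties.CommutativeSemigroup as CommSemigroupProperties
import Algebra.Properties.Ring as RingProperties
import Data.List.Properties as List
import Data.Nat.Properties as ℕ
import Data.Vec.Properties as Vec
import Relation.Binary.PropositionalEquality as ≡

map-allFin-suc : ∀ {a} {A : Set a} {m} (g : Fin (ℕ.suc m) → A) →
  List.map g (toList (allFin (ℕ.suc m))) ≡ g zero ∷ List.map (g ∘ suc) (toList (allFin m))
map-allFin-suc {m = m} g = ≡.cong (g zero ∷_) (begin
  List.map g (toList (Vec.tabulate suc))        ≡⟨ ≡.cong (List.map g ∘ toList) (Vec.tabulate-∘ suc id) ⟩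
  List.map g (toList (Vec.map suc (allFin m)))  ≡⟨ ≡.cong (List.map g) (Vec.toList-map suc (allFin m)) ⟩
  List.map g (List.map suc (toList (allFin m))) ≡⟨ List.map-∘ (toList (allFin m)) ⟨
  List.map (g ∘ suc) (toList (allFin m))        ∎)
  where open ≡.≡-Reasoning

size-flipAt : ∀ {m} (i : Fin m) (x : Vec Slot m) → size (flipAt i x) ≡ size x
size-flipAt zero    (none ∷ x) = ≡.refl
size-flipAt zero    (pos  ∷ x) = ≡.refl
size-flipAt zero    (neg  ∷ x) = ≡.refl
size-flipAt (suc i) (none ∷ x) = size-flipAt i x
size-flipAt (suc i) (pos  ∷ x) = ≡.cong ℕ.suc (size-flipAt i x)
size-flipAt (suc i) (neg  ∷ x) = ≡.cong ℕ.suc (size-flipAt i x)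

disjoint-∷ : ∀ {m a₀ b₀} {a b : Subset m} → (∀ i → ¬ (i ∈ a₀ ∷ a × i ∈ b₀ ∷ b)) →
             ∀ i → ¬ (i ∈ a × i ∈ b)
disjoint-∷ a∩b≡∅ i (i∈a , i∈b) = a∩b≡∅ (suc i) (there i∈a , there i∈b)

module Eigenvectors {c ℓ} (F : Field c ℓ) where
  open Field F hiding (zero)
  open Over F
  open import Algebra.Solver.Ring.NaturalCoefficients.Default commutativeSemiring
  open CommSemigroupProperties +-commutativeSemigroup using (interchange; x∙yz≈y∙xz)
  open CommSemigroupProperties *-commutativeSemigroup using (x∙yz≈xz∙y)
  open RingProperties ring using (-1*x≈-x; -‿involutive; -‿+-comm)
  open import Relation.Binary.Reasoning.Setoid setoid

  sumF-cong : ∀ {A : Set} {f g : A → Carrier} (xs : List A) → (∀ x → f x ≈ g x) →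
              sumF (List.map f xs) ≈ sumF (List.map g xs)
  sumF-cong []       f≈g = refl
  sumF-cong (x ∷ xs) f≈g = +-cong (f≈g x) (sumF-cong xs f≈g)

  sumF-+ : ∀ {A : Set} (f g : A → Carrier) (xs : List A) →
           sumF (List.map (λ x → f x + g x) xs) ≈ sumF (List.map f xs) + sumF (List.map g xs)
  sumF-+ f g []       = sym (+-identityˡ 0#)
  sumF-+ f g (x ∷ xs) = trans (+-congˡ (sumF-+ f g xs)) (interchange (f x) (g x) _ _)

  sumF-*ˡ : ∀ {A : Set} (r : Carrier) (f : A → Carrier) (xs : List A) →
            sumF (List.map (λ x → r * f x) xs) ≈ r * sumF (List.map f xs)
  sumF-*ˡ r f []       = sym (zeroʳ r)
  sumF-*ˡ r f (x ∷ xs) = trans (+-congˡ (sumF-*ˡ r f xs)) (sym (distribˡ r (f x) _))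

  sumF-*ʳ : ∀ {A : Set} (r : Carrier) (f : A → Carrier) (xs : List A) →
            sumF (List.map (λ x → f x * r) xs) ≈ sumF (List.map f xs) * r
  sumF-*ʳ r f xs = begin
    sumF (List.map (λ x → f x * r) xs) ≈⟨ sumF-cong xs (λ x → *-comm (f x) r) ⟩
    sumF (List.map (λ x → r * f x) xs) ≈⟨ sumF-*ˡ r f xs ⟩
    r * sumF (List.map f xs)           ≈⟨ *-comm r _ ⟩
    sumF (List.map f xs) * r           ∎

  sumF-zero : ∀ {A : Set} (xs : List A) → sumF (List.map (λ _ → 0#) xs) ≈ 0#
  sumF-zero []       = refl
  sumF-zero (x ∷ xs) = trans (+-identityˡ _) (sumF-zero xs)

  allSlots : List Slot
  allSlots = none ∷ pos ∷ neg ∷ []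

  Σₛ : (Slot → Carrier) → Carrier
  Σₛ g = sumF (List.map g allSlots)

  Σₛ-cong : ∀ {f g : Slot → Carrier} → (∀ s → f s ≈ g s) → Σₛ f ≈ Σₛ g
  Σₛ-cong = sumF-cong allSlots

  Σₛ-single : ∀ (g : Slot → Carrier) t → (∀ s → ¬ s ≡ t → g s ≈ 0#) → Σₛ g ≈ g t
  Σₛ-single g none g≈0 = begin
    g none + (g pos + (g neg + 0#)) ≈⟨ +-congˡ (+-cong (g≈0 pos λ ()) (+-congʳ (g≈0 neg λ ()))) ⟩
    g none + (0# + (0# + 0#))       ≈⟨ +-congˡ (trans (+-identityˡ _) (+-identityˡ _)) ⟩
    g none + 0#                     ≈⟨ +-identityʳ _ ⟩
    g none                          ∎
  Σₛ-single g pos g≈0 = begin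
    g none + (g pos + (g neg + 0#)) ≈⟨ +-cong (g≈0 none λ ()) (+-congˡ (+-congʳ (g≈0 neg λ ()))) ⟩
    0# + (g pos + (0# + 0#))        ≈⟨ trans (+-identityˡ _) (+-congˡ (+-identityˡ _)) ⟩
    g pos + 0#                      ≈⟨ +-identityʳ _ ⟩
    g pos                           ∎
  Σₛ-single g neg g≈0 = begin
    g none + (g pos + (g neg + 0#)) ≈⟨ +-cong (g≈0 none λ ()) (+-congʳ (g≈0 pos λ ())) ⟩
    0# + (0# + (g neg + 0#))        ≈⟨ trans (+-identityˡ _) (+-identityˡ _) ⟩
    g neg + 0#                      ≈⟨ +-identityʳ _ ⟩
    g neg                           ∎

  sumF-allSlotVecs-suc : ∀ {m} (f : Vec Slot (ℕ.suc m) → Carrier) →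
    sumF (List.map f (allSlotVecs (ℕ.suc m))) ≈
    sumF (List.map (λ x → Σₛ (λ s → f (s ∷ x))) (allSlotVecs m))
  sumF-allSlotVecs-suc {m} f = go (allSlotVecs m)
    where
    go : (xs : List (Vec Slot m)) →
      sumF (List.map f (List.concatMap (λ x → List.map (_∷ x) allSlots) xs)) ≈
      sumF (List.map (λ x → Σₛ (λ s → f (s ∷ x))) xs)
    go []       = refl
    go (x ∷ xs) = trans (+-congˡ (+-congˡ (+-congˡ (go xs))))
      (solve 4 (λ a b c d → a :+ (b :+ (c :+ d)) := (a :+ (b :+ (c :+ con 0))) :+ d) refl _ _ _ _)

  δ-refl : ∀ {m} (x : Vec Slot m) → δ x x ≡ 1#
  δ-refl x with x ≟V x
  ... | yes _   = ≡.refl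
  ... | no  x≢x = ⊥-elim (x≢x ≡.refl)

  δ-≢ : ∀ {m} (x y : Vec Slot m) → ¬ x ≡ y → δ x y ≡ 0#
  δ-≢ x y x≢y with x ≟V y
  ... | yes x≡y = ⊥-elim (x≢y x≡y)
  ... | no  _   = ≡.refl

  δₛ : Slot → Slot → Carrier
  δₛ s t with s ≟S t
  ... | yes _ = 1#
  ... | no  _ = 0#

  δₛ-refl : ∀ s → δₛ s s ≡ 1#
  δₛ-refl none = ≡.refl
  δₛ-refl pos  = ≡.refl
  δₛ-refl neg  = ≡.refl

  δₛ-≢ : ∀ {s t} → ¬ s ≡ t → δₛ s t ≡ 0#
  δₛ-≢ {s} {t} s≢t with s ≟S t
  ... | yes s≡t = ⊥-elim (s≢t s≡t)
  ... | no  _   = ≡.refl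

  δ-∷ : ∀ {m} s t (x y : Vec Slot m) → δ (s ∷ x) (t ∷ y) ≈ δₛ s t * δ x y
  δ-∷ s t x y = by-cases (s ≟S t) (x ≟V y)
    where
    by-cases : Dec (s ≡ t) → Dec (x ≡ y) → δ (s ∷ x) (t ∷ y) ≈ δₛ s t * δ x y
    by-cases (no s≢t) _ = begin
      δ (s ∷ x) (t ∷ y) ≡⟨ δ-≢ (s ∷ x) (t ∷ y) (s≢t ∘ Vec.∷-injectiveˡ) ⟩
      0#                ≈⟨ zeroˡ _ ⟨
      0# * δ x y        ≡⟨ ≡.cong (_* δ x y) (δₛ-≢ s≢t) ⟨
      δₛ s t * δ x y    ∎
    by-cases (yes ≡.refl) (yes ≡.refl) = begin
      δ (s ∷ x) (s ∷ x) ≡⟨ δ-refl (s ∷ x) ⟩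
      1#                ≈⟨ *-identityʳ 1# ⟨
      1# * 1#           ≡⟨ ≡.cong₂ _*_ (δₛ-refl s) (δ-refl x) ⟨
      δₛ s s * δ x x    ∎
    by-cases (yes ≡.refl) (no x≢y) = begin
      δ (s ∷ x) (s ∷ y) ≡⟨ δ-≢ (s ∷ x) (s ∷ y) (x≢y ∘ Vec.∷-injectiveʳ) ⟩
      0#                ≈⟨ zeroʳ _ ⟨
      δₛ s s * 0#       ≡⟨ ≡.cong (δₛ s s *_) (δ-≢ x y x≢y) ⟨
      δₛ s s * δ x y    ∎

  Σₛ-δₛ : ∀ (g : Slot → Carrier) t → Σₛ (λ s → g s * δₛ s t) ≈ g t
  Σₛ-δₛ g t = begin
    Σₛ (λ s → g s * δₛ s t) ≈⟨ Σₛ-single (λ s → g s * δₛ s t) t (λ s s≢t → trans (*-congˡ (reflexive (δₛ-≢ s≢t))) (zeroʳ _)) ⟩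
    g t * δₛ t t            ≈⟨ trans (*-congˡ (reflexive (δₛ-refl t))) (*-identityʳ _) ⟩
    g t                     ∎

  δ-sift : ∀ {m} (h : Vec Slot m → Carrier) y →
           sumF (List.map (λ x → h x * δ x y) (allSlotVecs m)) ≈ h y
  δ-sift h [] = trans (+-identityʳ _) (*-identityʳ _)
  δ-sift {ℕ.suc m} h (t ∷ y) = begin
    sumF (List.map (λ x → h x * δ x (t ∷ y)) (allSlotVecs (ℕ.suc m)))
      ≈⟨ sumF-allSlotVecs-suc (λ x → h x * δ x (t ∷ y)) ⟩
    sumF (List.map (λ x → Σₛ (λ s → h (s ∷ x) * δ (s ∷ x) (t ∷ y))) (allSlotVecs m))
      ≈⟨ sumF-cong (allSlotVecs m) (λ x → Σₛ-cong (λ s → trans (*-congˡ (δ-∷ s t x y)) (x∙yz≈xz∙y (h (s ∷ x)) _ _))) ⟩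
    sumF (List.map (λ x → Σₛ (λ s → (h (s ∷ x) * δ x y) * δₛ s t)) (allSlotVecs m))
      ≈⟨ sumF-cong (allSlotVecs m) (λ x → Σₛ-δₛ (λ s → h (s ∷ x) * δ x y) t) ⟩
    sumF (List.map (λ x → h (t ∷ x) * δ x y) (allSlotVecs m))
      ≈⟨ δ-sift (λ x → h (t ∷ x)) y ⟩
    h (t ∷ y) ∎

  -- The summand of σ-basis is where-bound, hence unnameable; it is recovered here by unification.
  private
    σ-basis-summand : ∀ {m} (x y : Vec Slot m) →
      Σ (Fin m → Carrier) λ term → σ-basis x y ≡ sumF (List.map term (toList (allFin m)))
    σ-basis-summand x y = _ , ≡.refl

  flipTerm : ∀ {m} → Vec Slot m → Vec Slot m → Fin m → Carrier
  flipTerm x y = proj₁ (σ-basis-summand x y)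

  flipδ : Slot → Slot → Carrier
  flipδ none _ = 0#
  flipδ pos  t = δₛ neg t
  flipδ neg  t = δₛ pos t

  flipTerm-zero : ∀ {m} s t (x y : Vec Slot m) → flipTerm (s ∷ x) (t ∷ y) zero ≈ flipδ s t * δ x y
  flipTerm-zero none t x y = sym (zeroˡ _)
  flipTerm-zero pos  t x y = δ-∷ neg t x y
  flipTerm-zero neg  t x y = δ-∷ pos t x y

  flipTerm-suc : ∀ {m} s t (x y : Vec Slot m) i →
                 flipTerm (s ∷ x) (t ∷ y) (suc i) ≈ δₛ s t * flipTerm x y i
  flipTerm-suc s t x y i with lookup x i
  ... | none = sym (zeroʳ _)
  ... | pos  = δ-∷ s t (flipAt i x) y
  ... | neg  = δ-∷ s t (flipAt i x) y

  flipTerm-size : ∀ {m} (x y : Vec Slot m) i → ¬ size x ≡ size y → flipTerm x y i ≡ 0#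
  flipTerm-size x y i size≢ with lookup x i
  ... | none = ≡.refl
  ... | pos  = δ-≢ (flipAt i x) y λ { ≡.refl → size≢ (≡.sym (size-flipAt i x)) }
  ... | neg  = δ-≢ (flipAt i x) y λ { ≡.refl → size≢ (≡.sym (size-flipAt i x)) }

  σ-basis-∷ : ∀ {m} s t (x y : Vec Slot m) →
              σ-basis (s ∷ x) (t ∷ y) ≈ flipδ s t * δ x y + δₛ s t * σ-basis x y
  σ-basis-∷ {m} s t x y = begin
    sumF (List.map (flipTerm (s ∷ x) (t ∷ y)) (toList (allFin (ℕ.suc m))))
      ≡⟨ ≡.cong sumF (map-allFin-suc (flipTerm (s ∷ x) (t ∷ y))) ⟩
    flipTerm (s ∷ x) (t ∷ y) zero + sumF (List.map (flipTerm (s ∷ x) (t ∷ y) ∘ suc) (toList (allFin m)))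
      ≈⟨ +-cong (flipTerm-zero s t x y) (sumF-cong (toList (allFin m)) (flipTerm-suc s t x y)) ⟩
    flipδ s t * δ x y + sumF (List.map (λ i → δₛ s t * flipTerm x y i) (toList (allFin m)))
      ≈⟨ +-congˡ (sumF-*ˡ (δₛ s t) (flipTerm x y) (toList (allFin m))) ⟩
    flipδ s t * δ x y + δₛ s t * σ-basis x y ∎

  σ-basis-size≢ : ∀ {m} (x y : Vec Slot m) → ¬ size x ≡ size y → σ-basis x y ≈ 0#
  σ-basis-size≢ {m} x y size≢ = trans
    (sumF-cong (toList (allFin m)) (λ i → reflexive (flipTerm-size x y i size≢)))
    (sumF-zero (toList (allFin m)))

  -- σ on the direct sum ⊕ₖ Mᵐₖ, an element being a coefficient function on all encodings
  σ̃ : ∀ {m} → (Vec Slot m → Carrier) → Vec Slot m → Carrier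
  σ̃ {m} h y = sumF (List.map (λ x → h x * σ-basis x y) (allSlotVecs m))

  -- Likewise for the summand of σ.
  private
    σ-summand : ∀ {n} k (f : M n k) y (y-size : size y ≡ k) →
      Σ (Vec Slot n → Carrier) λ term → σ k f (y , y-size) ≡ sumF (List.map term (allSlotVecs n))
    σ-summand k f y y-size = _ , ≡.refl

  σ≈σ̃ : ∀ {n} k (f : M n k) (h : Vec Slot n → Carrier) → (∀ x x-size → f (x , x-size) ≈ h x) →
        ∀ y (y-size : size y ≡ k) → σ k f (y , y-size) ≈ σ̃ h y
  σ≈σ̃ {n} k f h f≈h y y-size = sumF-cong (allSlotVecs n) summand≈
    where
    summand≈ : ∀ x → proj₁ (σ-summand k f y y-size) x ≈ h x * σ-basis x y
    summand≈ x with size x ℕ.≟ k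
    ... | yes x-size = *-congʳ (f≈h x x-size)
    ... | no  x-size≢ = sym (trans (*-congˡ (σ-basis-size≢ x y (λ eq → x-size≢ (≡.trans eq y-size))))
                                   (zeroʳ _))

  σ̃-[] : ∀ (h : Vec Slot 0 → Carrier) → σ̃ h [] ≈ 0#
  σ̃-[] h = trans (+-identityʳ _) (zeroʳ _)

  σ₁ : (Slot → Carrier) → Slot → Carrier
  σ₁ φ none = 0#
  σ₁ φ pos  = φ neg
  σ₁ φ neg  = φ pos

  flipδ-≢ : ∀ {s t} → ¬ s ≡ bar t → flipδ s t ≡ 0#
  flipδ-≢ {none} _    = ≡.refl
  flipδ-≢ {pos}  s≢t̄ = δₛ-≢ (s≢t̄ ∘ ≡.cong bar)
  flipδ-≢ {neg}  s≢t̄ = δₛ-≢ (s≢t̄ ∘ ≡.cong bar)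

  Σₛ-flipδ : ∀ (φ : Slot → Carrier) t → Σₛ (λ s → φ s * flipδ s t) ≈ σ₁ φ t
  Σₛ-flipδ φ t = begin
    Σₛ (λ s → φ s * flipδ s t)
      ≈⟨ Σₛ-single (λ s → φ s * flipδ s t) (bar t)
           (λ s s≢t̄ → trans (*-congˡ (reflexive (flipδ-≢ s≢t̄))) (zeroʳ _)) ⟩
    φ (bar t) * flipδ (bar t) t
      ≈⟨ at t ⟩
    σ₁ φ t ∎
    where
    at : ∀ t → φ (bar t) * flipδ (bar t) t ≈ σ₁ φ t
    at none = zeroʳ _
    at pos  = *-identityʳ _
    at neg  = *-identityʳ _

  _⊗_ : ∀ {m} → (Slot → Carrier) → (Vec Slot m → Carrier) → Vec Slot (ℕ.suc m) → Carrier
  (φ ⊗ h) (s ∷ x) = φ s * h x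

  σ̃-⊗ : ∀ {m} (φ : Slot → Carrier) (h : Vec Slot m → Carrier) t y →
        σ̃ (φ ⊗ h) (t ∷ y) ≈ σ₁ φ t * h y + φ t * σ̃ h y
  σ̃-⊗ {m} φ h t y = begin
    σ̃ (φ ⊗ h) (t ∷ y)
      ≈⟨ sumF-allSlotVecs-suc (λ x → (φ ⊗ h) x * σ-basis x (t ∷ y)) ⟩
    sumF (List.map (λ x → Σₛ (λ s → (φ s * h x) * σ-basis (s ∷ x) (t ∷ y))) (allSlotVecs m))
      ≈⟨ sumF-cong (allSlotVecs m) slotwise ⟩
    sumF (List.map (λ x → σ₁ φ t * (h x * δ x y) + φ t * (h x * σ-basis x y)) (allSlotVecs m))
      ≈⟨ sumF-+ _ _ (allSlotVecs m) ⟩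
    sumF (List.map (λ x → σ₁ φ t * (h x * δ x y)) (allSlotVecs m)) +
    sumF (List.map (λ x → φ t * (h x * σ-basis x y)) (allSlotVecs m))
      ≈⟨ +-cong (sumF-*ˡ (σ₁ φ t) _ (allSlotVecs m)) (sumF-*ˡ (φ t) _ (allSlotVecs m)) ⟩
    σ₁ φ t * sumF (List.map (λ x → h x * δ x y) (allSlotVecs m)) + φ t * σ̃ h y
      ≈⟨ +-congʳ (*-congˡ (δ-sift h y)) ⟩
    σ₁ φ t * h y + φ t * σ̃ h y ∎
    where
    slotwise : ∀ x → Σₛ (λ s → (φ s * h x) * σ-basis (s ∷ x) (t ∷ y)) ≈
                     σ₁ φ t * (h x * δ x y) + φ t * (h x * σ-basis x y)
    slotwise x = begin
      Σₛ (λ s → (φ s * h x) * σ-basis (s ∷ x) (t ∷ y))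
        ≈⟨ Σₛ-cong (λ s → trans (*-congˡ (σ-basis-∷ s t x y)) (expand (φ s) (h x) _ _ _ _)) ⟩
      Σₛ (λ s → (φ s * flipδ s t) * D + (φ s * δₛ s t) * S)
        ≈⟨ sumF-+ (λ s → (φ s * flipδ s t) * D) (λ s → (φ s * δₛ s t) * S) allSlots ⟩
      Σₛ (λ s → (φ s * flipδ s t) * D) + Σₛ (λ s → (φ s * δₛ s t) * S)
        ≈⟨ +-cong (sumF-*ʳ D (λ s → φ s * flipδ s t) allSlots)
                  (sumF-*ʳ S (λ s → φ s * δₛ s t) allSlots) ⟩
      Σₛ (λ s → φ s * flipδ s t) * D + Σₛ (λ s → φ s * δₛ s t) * S
        ≈⟨ +-cong (*-congʳ (Σₛ-flipδ φ t)) (*-congʳ (Σₛ-δₛ φ t)) ⟩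
      σ₁ φ t * D + φ t * S ∎
      where
      D = h x * δ x y
      S = h x * σ-basis x y
      expand : ∀ p h f d e s → (p * h) * (f * d + e * s) ≈ (p * f) * (h * d) + (p * e) * (h * s)
      expand = solve 6 (λ p h f d e s → (p :* h) :* (f :* d :+ e :* s) :=
                                         (p :* f) :* (h :* d) :+ (p :* e) :* (h :* s)) refl

  bracketᵛ : ∀ {m} → Subset m → Subset m → Vec Slot m → Carrier
  bracketᵛ []        []        _ = 1#
  bracketᵛ (a₀ ∷ a) (b₀ ∷ b)   = factor a₀ b₀ ⊗ bracketᵛ a b

  bracket≡bracketᵛ : ∀ {m k} (a b : Subset m) x (x-size : size x ≡ k) →
                     bracket a b (x , x-size) ≡ bracketᵛ a b x
  bracket≡bracketᵛ []        []        []      _ = ≡.refl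
  bracket≡bracketᵛ (a₀ ∷ a) (b₀ ∷ b) (s ∷ x) _ = ≡.trans
    (≡.cong prodF (map-allFin-suc (λ i → factor (lookup (a₀ ∷ a) i) (lookup (b₀ ∷ b) i) (lookup (s ∷ x) i))))
    (≡.cong (factor a₀ b₀ s *_) (bracket≡bracketᵛ a b x ≡.refl))

  slotEigenvalue : Side → Side → Carrier
  slotEigenvalue inside  _       = 1#
  slotEigenvalue outside inside  = - 1#
  slotEigenvalue outside outside = 0#

  σ₁-factor : ∀ a₀ b₀ t → σ₁ (factor a₀ b₀) t ≈ slotEigenvalue a₀ b₀ * factor a₀ b₀ t
  σ₁-factor inside  _       none = sym (*-identityˡ _)
  σ₁-factor inside  _       pos  = sym (*-identityˡ _)
  σ₁-factor inside  _       neg  = sym (*-identityˡ _)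
  σ₁-factor outside inside  none = sym (zeroʳ _)
  σ₁-factor outside inside  pos  = sym (*-identityʳ _)
  σ₁-factor outside inside  neg  = sym (trans (-1*x≈-x (- 1#)) (-‿involutive 1#))
  σ₁-factor outside outside none = sym (zeroˡ _)
  σ₁-factor outside outside pos  = sym (zeroˡ _)
  σ₁-factor outside outside neg  = sym (zeroˡ _)

  eigenvalue : ∀ {m} → Subset m → Subset m → Carrier
  eigenvalue []        []        = 0#
  eigenvalue (a₀ ∷ a) (b₀ ∷ b) = slotEigenvalue a₀ b₀ + eigenvalue a b

  σ̃-bracketᵛ : ∀ {m} (a b : Subset m) y → σ̃ (bracketᵛ a b) y ≈ eigenvalue a b * bracketᵛ a b y
  σ̃-bracketᵛ []        []        []      = trans (σ̃-[] (bracketᵛ [] [])) (sym (zeroˡ _))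
  σ̃-bracketᵛ (a₀ ∷ a) (b₀ ∷ b) (t ∷ y) = begin
    σ̃ (φ ⊗ B) (t ∷ y)                      ≈⟨ σ̃-⊗ φ B t y ⟩
    σ₁ φ t * B y + φ t * σ̃ B y             ≈⟨ +-cong (*-congʳ (σ₁-factor a₀ b₀ t)) (*-congˡ (σ̃-bracketᵛ a b y)) ⟩
    (e₀ * φ t) * B y + φ t * (e * B y)     ≈⟨ regroup e₀ e (φ t) (B y) ⟩
    (e₀ + e) * (φ t * B y)                 ∎
    where
    φ  = factor a₀ b₀
    B  = bracketᵛ a b
    e₀ = slotEigenvalue a₀ b₀
    e  = eigenvalue a b
    regroup : ∀ e₀ e p q → (e₀ * p) * q + p * (e * q) ≈ (e₀ + e) * (p * q)
    regroup = solve 4 (λ e₀ e p q → (e₀ :* p) :* q :+ p :* (e :* q) := (e₀ :+ e) :* (p :* q)) refl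

  natF-+ : ∀ m n → natF (m ℕ.+ n) ≈ natF m + natF n
  natF-+ ℕ.zero    n = sym (+-identityˡ _)
  natF-+ (ℕ.suc m) n = trans (+-congˡ (natF-+ m n)) (sym (+-assoc _ _ _))

  natF[m]-natF[2n]≈natF[m∸n]-natF[n] : ∀ {m n} → n ≤ m →
    natF m - natF (2 ℕ.* n) ≈ natF (m ∸ n) - natF n
  natF[m]-natF[2n]≈natF[m∸n]-natF[n] {m} {n} n≤m = begin
    natF m - natF (2 ℕ.* n)
      ≡⟨ ≡.cong₂ (λ p q → natF p - natF q) (≡.sym (ℕ.m∸n+n≡m n≤m)) (≡.cong (n ℕ.+_) (ℕ.+-identityʳ n)) ⟩
    natF (m ∸ n ℕ.+ n) - natF (n ℕ.+ n)
      ≈⟨ +-cong (natF-+ (m ∸ n) n) (-‿cong (natF-+ n n)) ⟩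
    (A + B) - (B + B)
      ≈⟨ +-congˡ (-‿+-comm B B) ⟨
    (A + B) + (- B - B)
      ≈⟨ interchange A B (- B) (- B) ⟩
    (A - B) + (B - B)
      ≈⟨ +-congˡ (-‿inverseʳ B) ⟩
    (A - B) + 0#
      ≈⟨ +-identityʳ _ ⟩
    A - B ∎
    where
    A = natF (m ∸ n)
    B = natF n

  eigenvalue-disjoint : ∀ {m} (a b : Subset m) → (∀ i → ¬ (i ∈ a × i ∈ b)) →
                        eigenvalue a b ≈ natF (∣ a ∣) - natF (∣ b ∣)
  eigenvalue-disjoint []            []            _      = sym (-‿inverseʳ 0#)
  eigenvalue-disjoint (inside ∷ a)  (inside ∷ b)  a∩b≡∅ = ⊥-elim (a∩b≡∅ zero (here , here))
  eigenvalue-disjoint (inside ∷ a)  (outside ∷ b) a∩b≡∅ = begin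
    1# + eigenvalue a b                 ≈⟨ +-congˡ (eigenvalue-disjoint a b (disjoint-∷ a∩b≡∅)) ⟩
    1# + (natF (∣ a ∣) - natF (∣ b ∣))  ≈⟨ +-assoc _ _ _ ⟨
    (1# + natF (∣ a ∣)) - natF (∣ b ∣)  ∎
  eigenvalue-disjoint (outside ∷ a) (inside ∷ b)  a∩b≡∅ = begin
    - 1# + eigenvalue a b               ≈⟨ +-congˡ (eigenvalue-disjoint a b (disjoint-∷ a∩b≡∅)) ⟩
    - 1# + (natF (∣ a ∣) - natF (∣ b ∣))  ≈⟨ x∙yz≈y∙xz _ _ _ ⟩
    natF (∣ a ∣) + (- 1# - natF (∣ b ∣))  ≈⟨ +-congˡ (-‿+-comm 1# _) ⟩
    natF (∣ a ∣) - (1# + natF (∣ b ∣))    ∎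
  eigenvalue-disjoint (outside ∷ a) (outside ∷ b) a∩b≡∅ =
    trans (+-identityˡ _) (eigenvalue-disjoint a b (disjoint-∷ a∩b≡∅))

lemma2p2 : ∀ {c ℓ} (F : Field c ℓ) (n k j : ℕ) → j ≤ k → k ≤ n →
    (a b : Subset n) → (∀ i → ¬ (i ∈ a × i ∈ b)) →
    ∣ a ∣ ≡ k ∸ j → ∣ b ∣ ≡ j →
    let open Field F
        open Over F
    in _≈M_ {n} {k} (σ k (bracket a b)) ((natF k - natF (2 ℕ.* j)) · bracket a b)
lemma2p2 F n k j j≤k _ a b a∩b≡∅ ∣a∣≡k∸j ∣b∣≡j (y , y-size) = begin
  σ k (bracket a b) (y , y-size)
    ≈⟨ σ≈σ̃ k (bracket a b) (bracketᵛ a b) (λ x x-size → reflexive (bracket≡bracketᵛ a b x x-size)) y y-size ⟩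
  σ̃ (bracketᵛ a b) y
    ≈⟨ σ̃-bracketᵛ a b y ⟩
  eigenvalue a b * bracketᵛ a b y
    ≈⟨ *-cong eigenvalue≈ (reflexive (≡.sym (bracket≡bracketᵛ a b y y-size))) ⟩
  (natF k - natF (2 ℕ.* j)) * bracket a b (y , y-size) ∎
  where
  open Field F hiding (zero)
  open Over F
  open Eigenvectors F
  open import Relation.Binary.Reasoning.Setoid setoid

  eigenvalue≈ : eigenvalue a b ≈ natF k - natF (2 ℕ.* j)
  eigenvalue≈ = begin
    eigenvalue a b              ≈⟨ eigenvalue-disjoint a b a∩b≡∅ ⟩
    natF (∣ a ∣) - natF (∣ b ∣) ≡⟨ ≡.cong₂ (λ p q → natF p - natF q) ∣a∣≡k∸j ∣b∣≡j ⟩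
    natF (k ∸ j) - natF j       ≈⟨ natF[m]-natF[2n]≈natF[m∸n]-natF[n] j≤k ⟨
    natF k - natF (2 ℕ.* j)     ∎
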